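{- Let $H$ be a connected, Hamiltonian, subcubic graph and let $v_1 v_2\ldots v_{2p+1}$ be a Hamiltonian cycle of $H$ (indices taken modulo $2p+1$). If (1) there is an edge $v_iv_j\in E(H)$ that is a chord of the cycle (i.e. $v_i,v_j$ are not consecutive on it) with $d(v_{i-1})=d(v_{j-1})=2$, or (2) there is an edge $v_iv_j\in E(H)$ that is a chord of the cycle with $d(v_{i+1})=d(v_{j+1})=2$, or (3) there is an index $i$ with $d(v_{i-1})=d(v_{i+1})=2$, then $\chi'(H)=3$.
   Context: All graphs are finite and simple; $d(v)$ is the degree of $v$ in $H$; subcubic means maximum degree at most $3$; $\chi'$ denotes the chromatic index. -}

module Defs where

open import Data.Nat using (ℕ; zero; suc; _+_; _*_; _≤_; _<_)
open import Data.Nat.DivMod using (_mod_)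
open import Data.Fin using (Fin; toℕ)
open import Data.List using (map; allFin)
open import Data.Nat.ListAction using (sum)
open import Data.Bool using (Bool; true; false; if_then_else_)
open import Data.Product using (Σ; _×_)
open import Relation.Binary.PropositionalEquality using (_≡_; _≢_)
open import Relation.Nullary using (¬_)

record Graph (n : ℕ) : Set where
  field
    adj   : Fin n → Fin n → Bool
    sym   : ∀ u v → adj u v ≡ adj v u
    irrefl : ∀ u → adj u u ≡ false
open Graph public

Edge : ∀ {n} → Graph n → Fin n → Fin n → Set
Edge G u v = adj G u v ≡ true

degree : ∀ {n} → Graph n → Fin n → ℕ
degree {n} G u = sum (map (λ w → if adj G u w then 1 else 0) (allFin n))

Subcubic : ∀ {n} → Graph n → Set
Subcubic G = ∀ u → degree G u ≤ 3

sucMod : ∀ {k} → Fin (suc k) → Fin (suc k)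
sucMod {k} i = suc (toℕ i) mod (suc k)

predMod : ∀ {k} → Fin (suc k) → Fin (suc k)
predMod {k} i = (toℕ i + k) mod (suc k)

IsHamiltonianCycle : ∀ {n m} → Graph n → (Fin (suc m) → Fin n) → Set
IsHamiltonianCycle {n} {m} G v =
  (∀ i j → v i ≡ v j → i ≡ j) ×
  (∀ (x : Fin n) → Σ (Fin (suc m)) (λ i → v i ≡ x)) ×
  (∀ i → Edge G (v i) (v (sucMod i)))

ProperEdgeColouring : ∀ {n} → Graph n → (k : ℕ) → (Fin n → Fin n → Fin k) → Set
ProperEdgeColouring G k c =
  (∀ u v → Edge G u v → c u v ≡ c v u) ×
  (∀ u v w → Edge G u v → Edge G u w → v ≢ w → c u v ≢ c u w)

EdgeColourable : ∀ {n} → Graph n → ℕ → Set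
EdgeColourable {n} G k = Σ (Fin n → Fin n → Fin k) (ProperEdgeColouring G k)

ChromaticIndexIs : ∀ {n} → Graph n → ℕ → Set
ChromaticIndexIs G k = EdgeColourable G k × (∀ j → j < k → ¬ EdgeColourable G j)

{-# OPTIONS --safe #-}
module Submission where

-- Each colouring is made of a colour for every cycle edge and one for every chord. As H is
-- subcubic, every vertex lies on at most one chord, so such a colouring is proper as soon as consecutive
-- cycle edges differ and each chord differs from the cycle edges at both of its ends. Rotating the cycle
-- (and for (2) also reversing it) we may assume i = 0.
-- (1) The cycle edges entering v₀ and v_j get colour 2; the two remaining paths are coloured 0, 1, 0, …
-- starting at v₀ and at v_j; the chord v₀v_j gets 1 and all other chords 2, which never meet a cycle edge
-- of colour 2 because v_{-1} and v_{j-1} have degree 2.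
-- (3) Now v_{2p} and v₁ have degree 2. The cycle edges v₁v₂, v₃v₄, …, v_{2p-1}v_{2p} form a perfect
-- matching M of H − v₀, and M together with the chords of H − v₀ is a union of alternating paths and
-- cycles, coloured with 0 and 2; the remaining cycle edges get 1. The alternating path starting at v₁ has
-- only one other end, so it does not contain both v_{2p} and the chord partner of v₀: swapping 0 and 2
-- on this path leaves room for three distinct colours at v₀.
-- Conversely a 2-edge-colouring would alternate around the odd cycle.

open import Defs hiding (sym)
import Data.Bool as Bool
open import Data.Bool using (Bool; true; false; not; if_then_else_)
open import Data.Bool.Properties using (not-involutive; not-injective)
open import Data.Empty using (⊥-elim)
open import Data.Fin using (Fin; zero; suc; toℕ; fromℕ<; inject≤; opposite)
open import Data.Fin.Patterns using (0F; 1F; 2F)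
open import Data.Fin.Properties using (_≟_; toℕ-injective; toℕ-fromℕ<; any?; toℕ<n; toℕ≤pred[n]; inject≤-injective; pigeonhole; opposite-prop; opposite-involutive)
open import Data.Fin.Subset using (Subset; _∈_; _-_; ∣_∣)
open import Data.Fin.Subset.Properties using (x∈p∧x≢y⇒x∈p-y; x∈p⇒∣p-x∣<∣p∣)
open import Data.Maybe using (Maybe; just; nothing; _>>=_)
import Data.Maybe.Properties as Maybe
open import Data.Maybe.Properties using (just-injective)
open import Data.List using (List; []; _∷_; length; map; tabulate)
open import Data.List.Properties using (map-tabulate)
open import Data.List.Relation.Unary.All as All using (All; []; _∷_)
open import Data.List.Relation.Unary.AllPairs using ([]; _∷_)
open import Data.List.Relation.Unary.Unique.Propositional using (Unique)
open import Data.Nat using (ℕ; zero; suc; _+_; _*_; _∸_; _≤_; _<_; z≤n; s≤s; _%_)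
open import Data.Nat.DivMod using (m<n⇒m%n≡m; n%n≡0; [m+n]%n≡m%n)
open import Data.Nat.ListAction using (sum)
open import Data.Nat.Properties
  using (*-monoʳ-≤; *-suc; +-suc; +-∸-assoc; 1+n≢0; 1+n≢n; 1+n≰n; <⇒≢; <⇒≤; m<n⇒m<1+n; m≤n⇒m<n∨m≡n; n<1+n; n∸n≡0; n≤1+n; suc-injective; ≤-<-trans; ≤-antisym; ≤-pred; ≤-refl; ≤-trans; ≤∧≢⇒<; ≮⇒≥; _<?_)
import Data.Nat.Properties as ℕ
open import Data.Product using (Σ; ∃; ∃₂; _×_; _,_; proj₁; proj₂)
open import Data.Sum using (_⊎_; inj₁; inj₂)
import Data.Vec as Vec
open import Data.Vec.Properties using (lookup⇒[]=; lookup∘tabulate)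
open import Function using (_∘_; _⇔_; mk⇔)
open import Relation.Binary.PropositionalEquality using (_≡_; _≢_; refl; sym; trans; cong; subst; subst₂; module ≡-Reasoning)
open import Relation.Nullary using (¬_; Dec; yes; no; ¬?; does; contradiction)
open import Relation.Nullary.Decidable using (_×-dec_; _⊎-dec_; dec-true; dec-false; does-⇔)

private
  variable
    n m t : ℕ

neighbours : Graph n → Fin n → Subset n
neighbours G u = Vec.tabulate (adj G u)

sum-indicator≡∣tabulate∣ : (f : Fin n → Bool) →
  sum (tabulate (λ w → if f w then 1 else 0)) ≡ ∣ Vec.tabulate f ∣
sum-indicator≡∣tabulate∣ {zero} f = refl
sum-indicator≡∣tabulate∣ {suc n} f with f zero
... | true = cong suc (sum-indicator≡∣tabulate∣ (f ∘ suc))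
... | false = sum-indicator≡∣tabulate∣ (f ∘ suc)

degree≡∣neighbours∣ : (G : Graph n) (u : Fin n) → degree G u ≡ ∣ neighbours G u ∣
degree≡∣neighbours∣ G u =
  trans (cong sum (map-tabulate (λ w → w) (λ w → if adj G u w then 1 else 0))) (sum-indicator≡∣tabulate∣ (adj G u))

Edge⇒∈neighbours : (G : Graph n) {u w : Fin n} → Edge G u w → w ∈ neighbours G u
Edge⇒∈neighbours G {u} {w} e = lookup⇒[]= w _ (trans (lookup∘tabulate (adj G u) w) e)

Unique⇒length≤∣p∣ : {p : Subset n} {xs : List (Fin n)} → Unique xs → All (_∈ p) xs → length xs ≤ ∣ p ∣
Unique⇒length≤∣p∣ [] [] = z≤n
Unique⇒length≤∣p∣ {p = p} {x ∷ _} (x≢xs ∷ unique) (x∈p ∷ xs⊆p) =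
  ≤-<-trans (Unique⇒length≤∣p∣ unique (All.zipWith ∈-minus (xs⊆p , x≢xs))) (x∈p⇒∣p-x∣<∣p∣ x∈p)
  where
    ∈-minus : ∀ {y} → y ∈ p × x ≢ y → y ∈ p - x
    ∈-minus (y∈p , x≢y) = x∈p∧x≢y⇒x∈p-y y∈p (x≢y ∘ sym)

distinct-neighbours≤degree : (G : Graph n) {u : Fin n} {xs : List (Fin n)} →
  Unique xs → All (Edge G u) xs → length xs ≤ degree G u
distinct-neighbours≤degree G {u} unique edges =
  subst (_ ≤_) (sym (degree≡∣neighbours∣ G u)) (Unique⇒length≤∣p∣ unique (All.map (Edge⇒∈neighbours G) edges))

Edge-sym : (G : Graph n) {x y : Fin n} → Edge G x y → Edge G y x
Edge-sym G {x} {y} e = trans (Graph.sym G y x) e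

Edge-irrefl : (G : Graph n) {x : Fin n} → ¬ Edge G x x
Edge-irrefl G {x} e with trans (sym e) (irrefl G x)
... | ()

EdgeColourable-mono : {G : Graph n} {j k : ℕ} → j ≤ k → EdgeColourable G j → EdgeColourable G k
EdgeColourable-mono j≤k (c , c-sym , c-proper) =
  (λ x y → inject≤ (c x y) j≤k) ,
  (λ x y e → cong (λ i → inject≤ i j≤k) (c-sym x y e)) ,
  (λ u x y ex ey x≢y eq → c-proper u x y ex ey x≢y (inject≤-injective j≤k j≤k _ _ eq))

toℕ-sucMod : {i : Fin (suc m)} → toℕ i < m → toℕ (sucMod i) ≡ suc (toℕ i)
toℕ-sucMod i<m = trans (toℕ-fromℕ< _) (m<n⇒m%n≡m (s≤s i<m))

sucMod-last : {i : Fin (suc m)} → toℕ i ≡ m → sucMod i ≡ zero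
sucMod-last {m} i≡m = toℕ-injective (trans (toℕ-fromℕ< _) (trans (cong (λ t → suc t % suc m) i≡m) (n%n≡0 (suc m))))

toℕ-predMod-zero : toℕ (predMod {m} zero) ≡ m
toℕ-predMod-zero = trans (toℕ-fromℕ< _) (m<n⇒m%n≡m (n<1+n _))

toℕ-predMod-suc : (i : Fin m) → toℕ (predMod (suc i)) ≡ toℕ i
toℕ-predMod-suc {m} i = begin
  toℕ (predMod (suc i))      ≡⟨ toℕ-fromℕ< _ ⟩
  (suc (toℕ i) + m) % suc m  ≡⟨ cong (_% suc m) (sym (+-suc (toℕ i) m)) ⟩
  (toℕ i + suc m) % suc m    ≡⟨ [m+n]%n≡m%n (toℕ i) (suc m) ⟩
  toℕ i % suc m              ≡⟨ m<n⇒m%n≡m (≤-trans (toℕ<n i) (n≤1+n m)) ⟩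
  toℕ i                      ∎
  where open ≡-Reasoning

sucMod-predMod : (i : Fin (suc m)) → sucMod (predMod i) ≡ i
sucMod-predMod zero = sucMod-last toℕ-predMod-zero
sucMod-predMod (suc i) = toℕ-injective (begin
  toℕ (sucMod (predMod (suc i)))  ≡⟨ toℕ-sucMod (subst (_< _) (sym (toℕ-predMod-suc i)) (toℕ<n i)) ⟩
  suc (toℕ (predMod (suc i)))     ≡⟨ cong suc (toℕ-predMod-suc i) ⟩
  suc (toℕ i)                     ∎)
  where open ≡-Reasoning

toℕ-predMod : {i : Fin (suc m)} → toℕ i ≡ suc t → toℕ (predMod i) ≡ t
toℕ-predMod {i = suc i} eq = trans (toℕ-predMod-suc i) (suc-injective eq)

predMod-view : (i : Fin (suc m)) → i ≡ zero ⊎ toℕ i ≡ suc (toℕ (predMod i))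
predMod-view zero = inj₁ refl
predMod-view (suc i) = inj₂ (cong suc (sym (toℕ-predMod-suc i)))

predMod-sucMod : (i : Fin (suc m)) → predMod (sucMod i) ≡ i
predMod-sucMod {m} i with m≤n⇒m<n∨m≡n (toℕ≤pred[n] i)
... | inj₁ i<m = toℕ-injective (toℕ-predMod (toℕ-sucMod i<m))
... | inj₂ i≡m = toℕ-injective (begin
  toℕ (predMod (sucMod i))  ≡⟨ cong (toℕ ∘ predMod) (sucMod-last i≡m) ⟩
  toℕ (predMod {m} zero)    ≡⟨ toℕ-predMod-zero ⟩
  m                         ≡⟨ sym i≡m ⟩
  toℕ i                     ∎)
  where open ≡-Reasoning

sucMod-injective : {i j : Fin (suc m)} → sucMod i ≡ sucMod j → i ≡ j
sucMod-injective {i = i} {j} eq = trans (sym (predMod-sucMod i)) (trans (cong predMod eq) (predMod-sucMod j))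

predMod-injective : {i j : Fin (suc m)} → predMod i ≡ predMod j → i ≡ j
predMod-injective {i = i} {j} eq = trans (sym (sucMod-predMod i)) (trans (cong sucMod eq) (sucMod-predMod j))

sucMod≢predMod : 2 ≤ m → (i : Fin (suc m)) → sucMod i ≢ predMod i
sucMod≢predMod 2≤m zero eq = <⇒≢ 2≤m (trans (sym (toℕ-sucMod (≤-trans (s≤s z≤n) 2≤m))) (trans (cong toℕ eq) toℕ-predMod-zero))
sucMod≢predMod {m} 2≤m (suc i) eq with m≤n⇒m<n∨m≡n (toℕ≤pred[n] (suc i))
... | inj₁ i<m = <⇒≢ (m<n⇒m<1+n (n<1+n (toℕ i))) (begin
  toℕ i                        ≡⟨ sym (toℕ-predMod-suc i) ⟩
  toℕ (predMod (suc i))        ≡⟨ cong toℕ (sym eq) ⟩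
  toℕ (sucMod (suc i))         ≡⟨ toℕ-sucMod i<m ⟩
  suc (suc (toℕ i))            ∎)
  where open ≡-Reasoning
... | inj₂ i≡m = <⇒≢ 2≤m (begin
  1                            ≡⟨ cong (suc ∘ toℕ) (sym (sucMod-last i≡m)) ⟩
  suc (toℕ (sucMod (suc i)))   ≡⟨ cong (suc ∘ toℕ) eq ⟩
  suc (toℕ (predMod (suc i)))  ≡⟨ cong suc (toℕ-predMod-suc i) ⟩
  suc (toℕ i)                  ≡⟨ i≡m ⟩
  m                            ∎)
  where open ≡-Reasoning

rotate : ℕ → Fin (suc m) → Fin (suc m)
rotate zero i = i
rotate (suc t) i = sucMod (rotate t i)

rotateBack : ℕ → Fin (suc m) → Fin (suc m)
rotateBack zero i = i
rotateBack (suc t) i = predMod (rotateBack t i)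

rotate-sucMod : (t : ℕ) (i : Fin (suc m)) → rotate t (sucMod i) ≡ sucMod (rotate t i)
rotate-sucMod zero i = refl
rotate-sucMod (suc t) i = cong sucMod (rotate-sucMod t i)

rotate-predMod : (t : ℕ) (i : Fin (suc m)) → rotate t (predMod i) ≡ predMod (rotate t i)
rotate-predMod t i = begin
  rotate t (predMod i)                     ≡⟨ sym (predMod-sucMod _) ⟩
  predMod (sucMod (rotate t (predMod i)))  ≡⟨ cong predMod (sym (rotate-sucMod t (predMod i))) ⟩
  predMod (rotate t (sucMod (predMod i)))  ≡⟨ cong (predMod ∘ rotate t) (sucMod-predMod i) ⟩
  predMod (rotate t i)                     ∎
  where open ≡-Reasoning

rotate-injective : (t : ℕ) {i j : Fin (suc m)} → rotate t i ≡ rotate t j → i ≡ j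
rotate-injective zero eq = eq
rotate-injective (suc t) eq = rotate-injective t (sucMod-injective eq)

rotate-rotateBack : (t : ℕ) (i : Fin (suc m)) → rotate t (rotateBack t i) ≡ i
rotate-rotateBack zero i = refl
rotate-rotateBack (suc t) i = begin
  sucMod (rotate t (predMod (rotateBack t i)))  ≡⟨ cong sucMod (rotate-predMod t _) ⟩
  sucMod (predMod (rotate t (rotateBack t i)))  ≡⟨ sucMod-predMod _ ⟩
  rotate t (rotateBack t i)                     ≡⟨ rotate-rotateBack t i ⟩
  i                                             ∎
  where open ≡-Reasoning

toℕ-rotate-zero : t ≤ m → toℕ (rotate {m} t zero) ≡ t
toℕ-rotate-zero {zero} _ = refl
toℕ-rotate-zero {suc t} t<m = trans (toℕ-sucMod (subst (_< _) (sym ih) t<m)) (cong suc ih)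
  where
    ih : toℕ (rotate t zero) ≡ t
    ih = toℕ-rotate-zero (<⇒≤ t<m)

rotate-toℕ : (i : Fin (suc m)) → rotate (toℕ i) zero ≡ i
rotate-toℕ i = toℕ-injective (toℕ-rotate-zero (toℕ≤pred[n] i))

opposite-sucMod : (i : Fin (suc m)) → opposite (sucMod i) ≡ predMod (opposite i)
opposite-sucMod {m} i with m≤n⇒m<n∨m≡n (toℕ≤pred[n] i)
... | inj₁ i<m = toℕ-injective (begin
  toℕ (opposite (sucMod i))     ≡⟨ opposite-prop (sucMod i) ⟩
  m ∸ toℕ (sucMod i)            ≡⟨ cong (m ∸_) (toℕ-sucMod i<m) ⟩
  m ∸ suc (toℕ i)               ≡⟨ sym (toℕ-predMod (trans (opposite-prop i) (+-∸-assoc 1 i<m))) ⟩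
  toℕ (predMod (opposite i))    ∎)
  where open ≡-Reasoning
... | inj₂ i≡m = toℕ-injective (begin
  toℕ (opposite (sucMod i))     ≡⟨ cong (toℕ ∘ opposite) (sucMod-last i≡m) ⟩
  toℕ (opposite {suc m} zero)   ≡⟨ opposite-prop zero ⟩
  m                             ≡⟨ sym toℕ-predMod-zero ⟩
  toℕ (predMod {m} zero)        ≡⟨ cong (toℕ ∘ predMod) (sym opposite≡zero) ⟩
  toℕ (predMod (opposite i))    ∎)
  where
    open ≡-Reasoning
    opposite≡zero : opposite i ≡ zero
    opposite≡zero = toℕ-injective (trans (opposite-prop i) (trans (cong (m ∸_) i≡m) (n∸n≡0 m)))

consecutive-positions-≢ : {A : Set} (f : ℕ → A) → f m ≢ f 0 → (∀ {t} → t < m → f t ≢ f (suc t)) →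
  (i : Fin (suc m)) → f (toℕ (predMod i)) ≢ f (toℕ i)
consecutive-positions-≢ {m} f wrap step i with predMod-view i
... | inj₁ refl = subst (λ t → f t ≢ f 0) (sym toℕ-predMod-zero) wrap
... | inj₂ i≡1+Pi = subst (λ t → f (toℕ (predMod i)) ≢ f t) (sym i≡1+Pi) (step (subst (_≤ m) i≡1+Pi (toℕ≤pred[n] i)))

toℕ≡m⇒≡predMod-zero : {i : Fin (suc m)} → toℕ i ≡ m → i ≡ predMod zero
toℕ≡m⇒≡predMod-zero i≡m = toℕ-injective (trans i≡m (sym toℕ-predMod-zero))

suc-toℕ≡toℕ⇒≡predMod : {i j : Fin (suc m)} → suc (toℕ i) ≡ toℕ j → i ≡ predMod j
suc-toℕ≡toℕ⇒≡predMod {m} {i} {j} eq = trans (sym (predMod-sucMod i)) (cong predMod Si≡j)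
  where
    Si≡j : sucMod i ≡ j
    Si≡j = toℕ-injective (trans (toℕ-sucMod (subst (_≤ m) (sym eq) (toℕ≤pred[n] j))) eq)

opposite-predMod : (i : Fin (suc m)) → opposite (predMod i) ≡ sucMod (opposite i)
opposite-predMod i = begin
  opposite (predMod i)                           ≡⟨ sym (sucMod-predMod _) ⟩
  sucMod (predMod (opposite (predMod i)))        ≡⟨ cong sucMod (sym (opposite-sucMod (predMod i))) ⟩
  sucMod (opposite (sucMod (predMod i)))         ≡⟨ cong (sucMod ∘ opposite) (sucMod-predMod i) ⟩
  sucMod (opposite i)                            ∎
  where open ≡-Reasoning

odd : ℕ → Bool
odd zero = false
odd (suc t) = not (odd t)

search : {N : ℕ} {Q : Fin N → Set} → (∀ y → Dec (Q y)) → Maybe (Fin N)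
search Q? with any? Q?
... | yes (y , _) = just y
... | no _ = nothing

module _ {N : ℕ} {Q : Fin N → Set} (Q? : ∀ y → Dec (Q y)) where

  search-sound : ∀ {y} → search Q? ≡ just y → Q y
  search-sound eq with any? Q?
  search-sound refl | yes (_ , qy) = qy

  search-complete : (∀ {y z} → Q y → Q z → y ≡ z) → ∀ {y} → Q y → search Q? ≡ just y
  search-complete unique qy with any? Q?
  ... | yes (_ , qz) = cong just (unique qz qy)
  ... | no ¬∃ = ⊥-elim (¬∃ (_ , qy))

  search-nothing : (∀ y → ¬ Q y) → search Q? ≡ nothing
  search-nothing none with any? Q?
  ... | yes (y , qy) = ⊥-elim (none y qy)
  ... | no _ = refl

module Orbit {N : ℕ} (f : Fin N → Maybe (Fin N))
  (f-injective : ∀ {x y z} → f x ≡ just z → f y ≡ just z → x ≡ y)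
  (x₀ : Fin N) (x₀∉image : ∀ {x} → f x ≢ just x₀) where

  orbit : ℕ → Maybe (Fin N)
  orbit zero = just x₀
  orbit (suc k) = orbit k >>= f

  private
    bind-just : ∀ {y} (mx : Maybe (Fin N)) → (mx >>= f) ≡ just y → ∃ λ x → mx ≡ just x × f x ≡ just y
    bind-just (just x) eq = x , refl , eq

    just≢nothing : ∀ {x : Fin N} → just x ≢ nothing
    just≢nothing ()

  orbit-step : ∀ {k x} → orbit k ≡ just x → orbit (suc k) ≡ f x
  orbit-step eq = cong (_>>= f) eq

  orbit-index-injective : ∀ {k l x} → orbit k ≡ just x → orbit l ≡ just x → k ≡ l
  orbit-index-injective {zero} {zero} _ _ = refl
  orbit-index-injective {zero} {suc l} refl eq with bind-just (orbit l) eq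
  ... | _ , _ , fw≡x₀ = ⊥-elim (x₀∉image fw≡x₀)
  orbit-index-injective {suc k} {zero} eq refl with bind-just (orbit k) eq
  ... | _ , _ , fw≡x₀ = ⊥-elim (x₀∉image fw≡x₀)
  orbit-index-injective {suc k} {suc l} eqk eql with bind-just (orbit k) eqk | bind-just (orbit l) eql
  ... | w , wk , fw | w′ , wl , fw′ =
    cong suc (orbit-index-injective wk (trans wl (cong just (f-injective fw′ fw))))

  orbit-defined-below : ∀ {k l y} → k ≤ l → orbit l ≡ just y → ∃ λ x → orbit k ≡ just x
  orbit-defined-below {l = l} k≤l eq with m≤n⇒m<n∨m≡n k≤l
  ... | inj₂ refl = _ , eq
  ... | inj₁ (s≤s {n = l′} k≤l′) with bind-just (orbit l′) eq
  ...   | _ , eq′ , _ = orbit-defined-below k≤l′ eq′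

  -- The orbit never repeats a point, so by pigeonhole it is undefined after N steps.
  orbit-index<N : ∀ {k x} → orbit k ≡ just x → k < N
  orbit-index<N {k} eq with k <? N
  ... | yes k<N = k<N
  ... | no k≮N = ⊥-elim (no-repetition (pigeonhole (n<1+n N) (proj₁ ∘ visit)))
    where
      visit : (i : Fin (suc N)) → ∃ λ x → orbit (toℕ i) ≡ just x
      visit i = orbit-defined-below (≤-trans (toℕ≤pred[n] i) (≮⇒≥ k≮N)) eq
      no-repetition : ¬ ∃₂ (λ i j → toℕ i < toℕ j × proj₁ (visit i) ≡ proj₁ (visit j))
      no-repetition (i , j , i<j , same) =
        <⇒≢ i<j (orbit-index-injective (proj₂ (visit i)) (trans (proj₂ (visit j)) (cong just (sym same))))

  OnOrbit : Fin N → Set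
  OnOrbit x = ∃ λ (k : Fin N) → orbit (toℕ k) ≡ just x

  onOrbit? : (x : Fin N) → Dec (OnOrbit x)
  onOrbit? x = any? (λ k → Maybe.≡-dec _≟_ (orbit (toℕ k)) (just x))

  private
    visited : ∀ k {x} → orbit k ≡ just x → OnOrbit x
    visited k eq = fromℕ< k<N , trans (cong orbit (toℕ-fromℕ< k<N)) eq
      where
        k<N : k < N
        k<N = orbit-index<N {k} eq

  start : OnOrbit x₀
  start = visited zero refl

  forward : ∀ {x y} → OnOrbit x → f x ≡ just y → OnOrbit y
  forward (k , eq) fx≡y = visited (suc (toℕ k)) (trans (orbit-step {toℕ k} eq) fx≡y)

  predecessor : ∀ {y} → OnOrbit y → y ≡ x₀ ⊎ ∃ λ x → OnOrbit x × f x ≡ just y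
  predecessor (k , eq) = from-index (toℕ k) eq
    where
      from-index : ∀ {y} k → orbit k ≡ just y → y ≡ x₀ ⊎ ∃ λ x → OnOrbit x × f x ≡ just y
      from-index zero refl = inj₁ refl
      from-index (suc k) eq with bind-just (orbit k) eq
      ... | x , eqx , fx≡y = inj₂ (x , visited k eqx , fx≡y)

  backward : ∀ {x y} → OnOrbit y → f x ≡ just y → OnOrbit x
  backward on-y fx≡y with predecessor on-y
  ... | inj₁ refl = ⊥-elim (x₀∉image fx≡y)
  ... | inj₂ (x′ , on-x′ , fx′≡y) = subst OnOrbit (f-injective fx′≡y fx≡y) on-x′

  end-unique : ∀ {x y} → OnOrbit x → f x ≡ nothing → OnOrbit y → f y ≡ nothing → x ≡ y
  end-unique (k , eqx) fx≡nothing (l , eqy) fy≡nothing =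
    just-injective (trans (sym eqx) (trans (cong orbit same-index) eqy))
    where
      ends-after : ∀ {k l x y} → orbit k ≡ just x → f x ≡ nothing → orbit l ≡ just y → l ≤ k
      ends-after {k} eqx fx≡nothing eqy = ≮⇒≥ λ k<l →
        just≢nothing (trans (sym (proj₂ (orbit-defined-below k<l eqy))) (trans (orbit-step {k} eqx) fx≡nothing))
      same-index : toℕ k ≡ toℕ l
      same-index = ≤-antisym (ends-after eqy fy≡nothing eqx) (ends-after eqx fx≡nothing eqy)

Chord : Graph n → (Fin (suc m) → Fin n) → Fin (suc m) → Fin (suc m) → Set
Chord G v i j = Edge G (v i) (v j) × j ≢ sucMod i × i ≢ sucMod j

Chord-rotate : {G : Graph n} {v : Fin (suc m) → Fin n} (t : ℕ) {i j : Fin (suc m)} →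
  Chord G v (rotate t i) (rotate t j) → Chord G (v ∘ rotate t) i j
Chord-rotate t {i} {j} (e , j≢Si , i≢Sj) =
  e , (λ eq → j≢Si (trans (cong (rotate t) eq) (rotate-sucMod t i))) ,
      (λ eq → i≢Sj (trans (cong (rotate t) eq) (rotate-sucMod t j)))

Chord-opposite : {G : Graph n} {v : Fin (suc m) → Fin n} {i j : Fin (suc m)} →
  Chord G v (opposite i) (opposite j) → Chord G (v ∘ opposite) i j
Chord-opposite {i = i} {j} (e , j≢Si , i≢Sj) =
  e , (λ eq → i≢Sj (reflect eq)) , (λ eq → j≢Si (reflect eq))
  where
    reflect : ∀ {a b} → b ≡ sucMod a → opposite a ≡ sucMod (opposite b)
    reflect {a} {b} eq = begin
      opposite a                              ≡⟨ sym (sucMod-predMod _) ⟩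
      sucMod (predMod (opposite a))           ≡⟨ cong sucMod (sym (opposite-sucMod a)) ⟩
      sucMod (opposite (sucMod a))            ≡⟨ cong (sucMod ∘ opposite) (sym eq) ⟩
      sucMod (opposite b)                     ∎
      where open ≡-Reasoning

Fin2-≢∧≢⇒≡ : {x y z : Fin 2} → x ≢ y → y ≢ z → x ≡ z
Fin2-≢∧≢⇒≡ {0F} {0F} x≢y _ = ⊥-elim (x≢y refl)
Fin2-≢∧≢⇒≡ {0F} {1F} {0F} _ _ = refl
Fin2-≢∧≢⇒≡ {0F} {1F} {1F} _ y≢z = ⊥-elim (y≢z refl)
Fin2-≢∧≢⇒≡ {1F} {0F} {0F} _ y≢z = ⊥-elim (y≢z refl)
Fin2-≢∧≢⇒≡ {1F} {0F} {1F} _ _ = refl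
Fin2-≢∧≢⇒≡ {1F} {1F} x≢y _ = ⊥-elim (x≢y refl)

module HamiltonianCycle {n m} (G : Graph n) (v : Fin (suc m) → Fin n)
  (ham : IsHamiltonianCycle G v) (2≤m : 2 ≤ m) where

  private
    S P : Fin (suc m) → Fin (suc m)
    S = sucMod
    P = predMod
    0<m : 0 < m
    0<m = ≤-trans (s≤s z≤n) 2≤m
    variable
      a b c : Fin (suc m)

  v≢ : a ≢ b → v a ≢ v b
  v≢ a≢b eq = a≢b (proj₁ ham _ _ eq)

  cycle-edge : ∀ a → Edge G (v a) (v (S a))
  cycle-edge = proj₂ (proj₂ ham)

  cycle-edge⁻ : ∀ a → Edge G (v a) (v (P a))
  cycle-edge⁻ a = Edge-sym G (subst (Edge G (v (P a)) ∘ v) (sucMod-predMod a) (cycle-edge (P a)))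

  Chord-sym : Chord G v a b → Chord G v b a
  Chord-sym (e , b≢Sa , a≢Sb) = Edge-sym G e , a≢Sb , b≢Sa

  Chord⇒≢predMod : Chord G v a b → b ≢ P a
  Chord⇒≢predMod {a} (_ , _ , a≢Sb) refl = a≢Sb (sym (sucMod-predMod a))

  Chord⇒≢ : Chord G v a b → b ≢ a
  Chord⇒≢ (e , _ , _) refl = Edge-irrefl G e

  Chord⇒3≤degree : Chord G v a b → 3 ≤ degree G (v a)
  Chord⇒3≤degree {a} ch@(e , b≢Sa , _) = distinct-neighbours≤degree G
    ((v≢ (sucMod≢predMod 2≤m a) ∷ v≢ (b≢Sa ∘ sym) ∷ []) ∷ (v≢ (Chord⇒≢predMod ch ∘ sym) ∷ []) ∷ [] ∷ [])
    (cycle-edge a ∷ cycle-edge⁻ a ∷ e ∷ [])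

  degree2⇒¬Chord : degree G (v a) ≡ 2 → ¬ Chord G v a b
  degree2⇒¬Chord deg≡2 ch = 1+n≰n (subst (3 ≤_) deg≡2 (Chord⇒3≤degree ch))

  chord? : ∀ a b → Dec (Chord G v a b)
  chord? a b = (adj G (v a) (v b) Bool.≟ true) ×-dec ¬? (b ≟ S a) ×-dec ¬? (a ≟ S b)

  ¬2-edge-colourable : odd m ≡ false → ¬ EdgeColourable G 2
  ¬2-edge-colourable m-even (c , c-sym , c-proper) =
    c-proper (v zero) (v (S zero)) (v (P zero)) (cycle-edge zero) (cycle-edge⁻ zero) (v≢ (sucMod≢predMod 2≤m zero)) (begin
      colour zero                  ≡⟨ sym last≡first ⟩
      colour (P zero)              ≡⟨ cong (c (v (P zero)) ∘ v) (sucMod-predMod zero) ⟩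
      c (v (P zero)) (v zero)      ≡⟨ sym (c-sym (v zero) (v (P zero)) (cycle-edge⁻ zero)) ⟩
      c (v zero) (v (P zero))      ∎)
    where
      open ≡-Reasoning
      colour : Fin (suc m) → Fin 2
      colour a = c (v a) (v (S a))
      colour-step : ∀ a → colour (S a) ≢ colour a
      colour-step a eq = c-proper (v (S a)) (v (S (S a))) (v a) (cycle-edge (S a)) (Edge-sym G (cycle-edge a))
        (v≢ SSa≢a) (trans eq (c-sym (v a) (v (S a)) (cycle-edge a)))
        where
          SSa≢a : S (S a) ≢ a
          SSa≢a eq = sucMod≢predMod 2≤m a (trans (sym (predMod-sucMod (S a))) (cong P eq))
      parity : ∀ t → (odd t ≡ false → colour (rotate t zero) ≡ colour zero) ×
                     (odd t ≡ true → colour (rotate t zero) ≢ colour zero)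
      parity zero = (λ _ → refl) , (λ ())
      parity (suc t) =
        (λ even → Fin2-≢∧≢⇒≡ (colour-step (rotate t zero)) (proj₂ (parity t) (not-injective even))) ,
        (λ odd′ eq → colour-step (rotate t zero) (trans eq (sym (proj₁ (parity t) (not-injective odd′)))))
      last≡first : colour (P zero) ≡ colour zero
      last≡first = subst (λ a → colour a ≡ colour zero) (toℕ≡m⇒≡predMod-zero (toℕ-rotate-zero ≤-refl))
        (proj₁ (parity m) m-even)

  relabel-isHamiltonianCycle : (π π⁻¹ : Fin (suc m) → Fin (suc m)) → (∀ {a b} → π a ≡ π b → a ≡ b) →
    (∀ a → π (π⁻¹ a) ≡ a) → (∀ a → Edge G (v (π a)) (v (π (S a)))) → IsHamiltonianCycle G (v ∘ π)
  relabel-isHamiltonianCycle π π⁻¹ π-injective π-section edges =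
    (λ a b eq → π-injective (proj₁ ham _ _ eq)) ,
    (λ x → π⁻¹ (proj₁ (proj₁ (proj₂ ham) x)) , trans (cong v (π-section _)) (proj₂ (proj₁ (proj₂ ham) x))) ,
    edges

  rotate-isHamiltonianCycle : ∀ t → IsHamiltonianCycle G (v ∘ rotate t)
  rotate-isHamiltonianCycle t = relabel-isHamiltonianCycle (rotate t) (rotateBack t) (rotate-injective t)
    (rotate-rotateBack t) λ a → subst (Edge G (v (rotate t a)) ∘ v) (sym (rotate-sucMod t a)) (cycle-edge (rotate t a))

  opposite-isHamiltonianCycle : IsHamiltonianCycle G (v ∘ opposite)
  opposite-isHamiltonianCycle = relabel-isHamiltonianCycle opposite opposite opposite-injective opposite-involutive
    λ a → subst (Edge G (v (opposite a)) ∘ v) (sym (opposite-sucMod a)) (cycle-edge⁻ (opposite a))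
    where
      opposite-injective : ∀ {a b : Fin (suc m)} → opposite a ≡ opposite b → a ≡ b
      opposite-injective {a} {b} eq = trans (sym (opposite-involutive a)) (trans (cong opposite eq) (opposite-involutive b))

  module _ (subcubic : Subcubic G) where

    Chord-unique : Chord G v a b → Chord G v a c → b ≡ c
    Chord-unique {a} {b} {c} chb@(eb , b≢Sa , _) chc@(ec , c≢Sa , _) with b ≟ c
    ... | yes b≡c = b≡c
    ... | no b≢c = ⊥-elim (1+n≰n (≤-trans 4≤degree (subcubic (v a))))
      where
        4≤degree : 4 ≤ degree G (v a)
        4≤degree = distinct-neighbours≤degree G
          ((v≢ (sucMod≢predMod 2≤m a) ∷ v≢ (b≢Sa ∘ sym) ∷ v≢ (c≢Sa ∘ sym) ∷ [])
            ∷ (v≢ (Chord⇒≢predMod chb ∘ sym) ∷ v≢ (Chord⇒≢predMod chc ∘ sym) ∷ [])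
            ∷ (v≢ b≢c ∷ []) ∷ [] ∷ [])
          (cycle-edge a ∷ cycle-edge⁻ a ∷ eb ∷ ec ∷ [])

    -- cycleColour a is the colour of the cycle edge v a v (S a).
    record CycleChordColouring (k : ℕ) : Set where
      field
        cycleColour : Fin (suc m) → Fin k
        chordColour : Fin (suc m) → Fin k
        cycleColour-proper : ∀ a → cycleColour (P a) ≢ cycleColour a
        chordColour-sym : Chord G v a b → chordColour a ≡ chordColour b
        chordColour≢predecessor : Chord G v a b → chordColour a ≢ cycleColour (P a)
        chordColour≢successor : Chord G v a b → chordColour a ≢ cycleColour a

    data Incidence : Set where
      succ pred chord : Incidence

    reverse : Incidence → Incidence
    reverse succ = pred
    reverse pred = succ
    reverse chord = chord

    data Neighbour (a : Fin (suc m)) : Incidence → Fin (suc m) → Set where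
      succ : Neighbour a succ (S a)
      pred : Neighbour a pred (P a)
      chord : Chord G v a b → Neighbour a chord b

    neighbour : Edge G (v a) (v b) → ∃ λ k → Neighbour a k b
    neighbour {a} {b} e with b ≟ S a | a ≟ S b
    ... | yes refl | _ = succ , succ
    ... | no _ | yes refl = pred , subst (Neighbour (S b) pred) (predMod-sucMod b) pred
    ... | no b≢Sa | no a≢Sb = chord , chord (e , b≢Sa , a≢Sb)

    neighbour-unique : ∀ {k} → Neighbour a k b → Neighbour a k c → b ≡ c
    neighbour-unique succ succ = refl
    neighbour-unique pred pred = refl
    neighbour-unique (chord chb) (chord chc) = Chord-unique chb chc

    neighbour-reverse : ∀ {k} → Neighbour a k b → Neighbour b (reverse k) a
    neighbour-reverse {a} succ = subst (Neighbour (S a) pred) (predMod-sucMod a) pred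
    neighbour-reverse {a} pred = subst (Neighbour (P a) succ) (sucMod-predMod a) succ
    neighbour-reverse (chord ch) = chord (Chord-sym ch)

    module _ {k} (κ : CycleChordColouring k) where
      open CycleChordColouring κ

      incidenceColour : Fin (suc m) → Incidence → Fin k
      incidenceColour a succ = cycleColour a
      incidenceColour a pred = cycleColour (P a)
      incidenceColour a chord = chordColour a

      incidenceColour-reverse : ∀ {l} → Neighbour a l b → incidenceColour a l ≡ incidenceColour b (reverse l)
      incidenceColour-reverse {a} succ = cong cycleColour (sym (predMod-sucMod a))
      incidenceColour-reverse pred = refl
      incidenceColour-reverse (chord ch) = chordColour-sym ch

      incidenceColour-injective : ∀ {l l′} → Neighbour a l b → Neighbour a l′ c →
        incidenceColour a l ≡ incidenceColour a l′ → l ≡ l′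
      incidenceColour-injective succ succ _ = refl
      incidenceColour-injective {a} succ pred eq = ⊥-elim (cycleColour-proper a (sym eq))
      incidenceColour-injective succ (chord ch) eq = ⊥-elim (chordColour≢successor ch (sym eq))
      incidenceColour-injective {a} pred succ eq = ⊥-elim (cycleColour-proper a eq)
      incidenceColour-injective pred pred _ = refl
      incidenceColour-injective pred (chord ch) eq = ⊥-elim (chordColour≢predecessor ch (sym eq))
      incidenceColour-injective (chord ch) succ eq = ⊥-elim (chordColour≢successor ch eq)
      incidenceColour-injective (chord ch) pred eq = ⊥-elim (chordColour≢predecessor ch eq)
      incidenceColour-injective (chord _) (chord _) _ = refl

      edgeColour : Fin (suc m) → Fin (suc m) → Fin k
      edgeColour a b with b ≟ S a | a ≟ S b
      ... | yes _ | _ = cycleColour a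
      ... | no _ | yes _ = cycleColour b
      ... | no _ | no _ = chordColour a

      edgeColour-neighbour : ∀ {l} → Neighbour a l b → edgeColour a b ≡ incidenceColour a l
      edgeColour-neighbour {a} succ with S a ≟ S a
      ... | yes _ = refl
      ... | no Sa≢Sa = ⊥-elim (Sa≢Sa refl)
      edgeColour-neighbour {a} pred with P a ≟ S a | a ≟ S (P a)
      ... | yes Pa≡Sa | _ = ⊥-elim (sucMod≢predMod 2≤m a (sym Pa≡Sa))
      ... | no _ | yes _ = refl
      ... | no _ | no a≢SPa = ⊥-elim (a≢SPa (sym (sucMod-predMod a)))
      edgeColour-neighbour {a} {b} (chord (_ , b≢Sa , a≢Sb)) with b ≟ S a | a ≟ S b
      ... | yes b≡Sa | _ = ⊥-elim (b≢Sa b≡Sa)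
      ... | no _ | yes a≡Sb = ⊥-elim (a≢Sb a≡Sb)
      ... | no _ | no _ = refl

      edgeColour-sym : Edge G (v a) (v b) → edgeColour a b ≡ edgeColour b a
      edgeColour-sym e with neighbour e
      ... | _ , nb = trans (edgeColour-neighbour nb)
        (trans (incidenceColour-reverse nb) (sym (edgeColour-neighbour (neighbour-reverse nb))))

      edgeColour-proper : Edge G (v a) (v b) → Edge G (v a) (v c) → b ≢ c → edgeColour a b ≢ edgeColour a c
      edgeColour-proper {a} {b} {c} eb ec b≢c eq with neighbour eb | neighbour ec
      ... | l , nb | l′ , nc = b≢c (neighbour-unique nb (subst (λ l → Neighbour a l c) (sym l≡l′) nc))
        where
          l≡l′ : l ≡ l′
          l≡l′ = incidenceColour-injective nb nc
            (trans (sym (edgeColour-neighbour nb)) (trans eq (edgeColour-neighbour nc)))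

      edgeColourable : EdgeColourable G k
      edgeColourable = (λ x y → edgeColour (index x) (index y)) ,
        (λ x y e → edgeColour-sym (index-edge e)) ,
        (λ u x y eux euy x≢y → edgeColour-proper (index-edge eux) (index-edge euy) (x≢y ∘ index-injective))
        where
          index : Fin n → Fin (suc m)
          index x = proj₁ (proj₁ (proj₂ ham) x)
          v-index : ∀ x → v (index x) ≡ x
          v-index x = proj₂ (proj₁ (proj₂ ham) x)
          index-edge : ∀ {x y} → Edge G x y → Edge G (v (index x)) (v (index y))
          index-edge {x} {y} = subst₂ (Edge G) (sym (v-index x)) (sym (v-index y))
          index-injective : ∀ {x y} → index x ≡ index y → x ≡ y
          index-injective {x} {y} eq = trans (sym (v-index x)) (trans (cong v eq) (v-index y))

    pathColour : Bool → Fin 3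
    pathColour true = 0F
    pathColour false = 1F

    pathColour≢2F : ∀ b → pathColour b ≢ 2F
    pathColour≢2F true ()
    pathColour≢2F false ()

    pathColour-not : ∀ b → pathColour b ≢ pathColour (not b)
    pathColour-not true ()
    pathColour-not false ()

    module ChordAfterDegree2 (j : Fin (suc m)) (chord0j : Chord G v zero j)
      (deg-P0 : degree G (v (P zero)) ≡ 2) (deg-Pj : degree G (v (P j)) ≡ 2) where

      private
        J : ℕ
        J = toℕ j

      J≡1+Pj : J ≡ suc (toℕ (P j))
      J≡1+Pj with predMod-view j
      ... | inj₁ j≡0 = ⊥-elim (Chord⇒≢ chord0j j≡0)
      ... | inj₂ eq = eq

      J≢m : J ≢ m
      J≢m J≡m = Chord⇒≢predMod chord0j (toℕ≡m⇒≡predMod-zero J≡m)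

      EntersEndpoint : ℕ → Set
      EntersEndpoint t = t ≡ m ⊎ suc t ≡ J

      entersEndpoint? : ∀ t → Dec (EntersEndpoint t)
      entersEndpoint? t = (t ℕ.≟ m) ⊎-dec (suc t ℕ.≟ J)

      phase : ℕ → Bool
      phase zero = true
      phase (suc t) = if does (suc t ℕ.≟ J) then true else not (phase t)

      -- colour t is the colour of the cycle edge v_t v_{t+1}.
      colour : ℕ → Fin 3
      colour t = if does (entersEndpoint? t) then 2F else pathColour (phase t)

      colour-entering : ∀ {t} → EntersEndpoint t → colour t ≡ 2F
      colour-entering {t} ent rewrite dec-true (entersEndpoint? t) ent = refl

      colour-path : ∀ {t} → ¬ EntersEndpoint t → colour t ≡ pathColour (phase t)
      colour-path {t} ¬ent rewrite dec-false (entersEndpoint? t) ¬ent = refl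

      colour≡2F : ∀ {t} → colour t ≡ 2F → EntersEndpoint t
      colour≡2F {t} eq with entersEndpoint? t
      ... | yes ent = ent
      ... | no ¬ent = ⊥-elim (pathColour≢2F (phase t) (trans (sym (colour-path ¬ent)) eq))

      colour-0 : colour 0 ≡ 0F
      colour-0 = colour-path λ where
        (inj₁ 0≡m) → <⇒≢ 0<m 0≡m
        (inj₂ 1≡J) → proj₁ (proj₂ chord0j) (toℕ-injective (trans (sym 1≡J) (sym (toℕ-sucMod 0<m))))

      phase-reset : ∀ {t} → suc t ≡ J → phase (suc t) ≡ true
      phase-reset {t} eq rewrite dec-true (suc t ℕ.≟ J) eq = refl

      phase-step : ∀ {t} → suc t ≢ J → phase (suc t) ≡ not (phase t)
      phase-step {t} ne rewrite dec-false (suc t ℕ.≟ J) ne = refl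

      colour-J : colour J ≡ 0F
      colour-J = trans (colour-path ¬entecial) (cong pathColour phase-J)
        where
          ¬entecial : ¬ EntersEndpoint J
          ¬entecial (inj₁ J≡m) = J≢m J≡m
          ¬entecial (inj₂ 1+J≡J) = 1+n≢n 1+J≡J
          phase-J : phase J ≡ true
          phase-J = subst (λ t → phase t ≡ true) (sym J≡1+Pj) (phase-reset (sym J≡1+Pj))

      colour-wrap : colour m ≢ colour 0
      colour-wrap eq = contradiction (trans (sym (colour-entering (inj₁ refl))) (trans eq colour-0)) λ ()

      colour-step : ∀ {t} → t < m → colour t ≢ colour (suc t)
      colour-step {t} t<m with entersEndpoint? t | entersEndpoint? (suc t)
      ... | yes (inj₁ t≡m) | _ = ⊥-elim (<⇒≢ t<m t≡m)
      ... | yes (inj₂ 1+t≡J) | yes (inj₁ 1+t≡m) = ⊥-elim (J≢m (trans (sym 1+t≡J) 1+t≡m))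
      ... | yes (inj₂ 1+t≡J) | yes (inj₂ 2+t≡J) = ⊥-elim (1+n≢n (trans 2+t≡J (sym 1+t≡J)))
      ... | yes ent | no ¬ent′ = λ eq →
        pathColour≢2F _ (trans (sym (colour-path ¬ent′)) (trans (sym eq) (colour-entering ent)))
      ... | no ¬ent | yes ent′ = λ eq →
        pathColour≢2F _ (trans (sym (colour-path ¬ent)) (trans eq (colour-entering ent′)))
      ... | no ¬ent | no ¬ent′ = λ eq → pathColour-not (phase t) (begin
        pathColour (phase t)        ≡⟨ sym (colour-path ¬ent) ⟩
        colour t                    ≡⟨ eq ⟩
        colour (suc t)              ≡⟨ colour-path ¬ent′ ⟩
        pathColour (phase (suc t))  ≡⟨ cong pathColour (phase-step (¬ent ∘ inj₂)) ⟩
        pathColour (not (phase t))  ∎)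
        where open ≡-Reasoning

      Endpoint : Fin (suc m) → Set
      Endpoint a = a ≡ zero ⊎ a ≡ j

      endpoint? : ∀ a → Dec (Endpoint a)
      endpoint? a = (a ≟ zero) ⊎-dec (a ≟ j)

      Chord-Endpoint : Chord G v a b → Endpoint a → Endpoint b
      Chord-Endpoint ch (inj₁ refl) = inj₂ (Chord-unique ch chord0j)
      Chord-Endpoint ch (inj₂ refl) = inj₁ (Chord-unique ch (Chord-sym chord0j))

      chordColour : Fin (suc m) → Fin 3
      chordColour a = if does (endpoint? a) then 1F else 2F

      chordColour-endpoint : Endpoint a → chordColour a ≡ 1F
      chordColour-endpoint {a} e rewrite dec-true (endpoint? a) e = refl

      chordColour-inner : ¬ Endpoint a → chordColour a ≡ 2F
      chordColour-inner {a} ¬e rewrite dec-false (endpoint? a) ¬e = refl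

      colour-predecessor-endpoint : Endpoint a → colour (toℕ (P a)) ≡ 2F
      colour-predecessor-endpoint (inj₁ refl) = colour-entering (inj₁ toℕ-predMod-zero)
      colour-predecessor-endpoint (inj₂ refl) = colour-entering (inj₂ (sym J≡1+Pj))

      colour-endpoint : Endpoint a → colour (toℕ a) ≡ 0F
      colour-endpoint (inj₁ refl) = colour-0
      colour-endpoint (inj₂ refl) = colour-J

      chordColour≢predecessor : Chord G v a b → chordColour a ≢ colour (toℕ (P a))
      chordColour≢predecessor {a} ch eq with endpoint? a
      ... | yes e = contradiction (trans (sym (chordColour-endpoint e)) (trans eq (colour-predecessor-endpoint e))) λ ()
      ... | no ¬e = ¬e (predecessor-special (colour≡2F (trans (sym eq) (chordColour-inner ¬e))))
        where
          predecessor-special : EntersEndpoint (toℕ (P a)) → Endpoint a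
          predecessor-special (inj₁ Pa≡m) = inj₁ (predMod-injective (toℕ≡m⇒≡predMod-zero Pa≡m))
          predecessor-special (inj₂ 1+Pa≡J) = inj₂ (predMod-injective (suc-toℕ≡toℕ⇒≡predMod 1+Pa≡J))

      chordColour≢successor : Chord G v a b → chordColour a ≢ colour (toℕ a)
      chordColour≢successor {a} ch eq with endpoint? a
      ... | yes e = contradiction (trans (sym (chordColour-endpoint e)) (trans eq (colour-endpoint e))) λ ()
      ... | no ¬e = ¬entecial (colour≡2F (trans (sym eq) (chordColour-inner ¬e)))
        where
          ¬entecial : ¬ EntersEndpoint (toℕ a)
          ¬entecial (inj₁ a≡m) = degree2⇒¬Chord deg-P0 (subst (λ c → Chord G v c _) (toℕ≡m⇒≡predMod-zero a≡m) ch)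
          ¬entecial (inj₂ 1+a≡J) = degree2⇒¬Chord deg-Pj (subst (λ c → Chord G v c _) (suc-toℕ≡toℕ⇒≡predMod 1+a≡J) ch)

      colouring : CycleChordColouring 3
      colouring = record
        { cycleColour = colour ∘ toℕ
        ; chordColour = chordColour
        ; cycleColour-proper = consecutive-positions-≢ colour colour-wrap colour-step
        ; chordColour-sym = λ ch → cong (λ e → if e then 1F else 2F)
            (does-⇔ (mk⇔ (Chord-Endpoint ch) (Chord-Endpoint (Chord-sym ch))) (endpoint? _) (endpoint? _))
        ; chordColour≢predecessor = chordColour≢predecessor
        ; chordColour≢successor = chordColour≢successor
        }

    module Degree2Neighbours (m-even : odd m ≡ false)
      (deg-P0 : degree G (v (P zero)) ≡ 2) (deg-S0 : degree G (v (S zero)) ≡ 2) where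

      S0≢0 : S zero ≢ zero
      S0≢0 eq = 1+n≢0 (trans (sym (toℕ-sucMod 0<m)) (cong toℕ eq))

      P0≢0 : P zero ≢ zero
      P0≢0 eq = <⇒≢ 0<m (sym (trans (sym toℕ-predMod-zero) (cong toℕ eq)))

      predMod≢zero : a ≢ S zero → P a ≢ zero
      predMod≢zero {a} a≢S0 Pa≡0 = a≢S0 (trans (sym (sucMod-predMod a)) (cong S Pa≡0))

      odd-predMod : a ≢ zero → odd (toℕ a) ≡ not (odd (toℕ (P a)))
      odd-predMod {a} a≢0 with predMod-view a
      ... | inj₁ a≡0 = ⊥-elim (a≢0 a≡0)
      ... | inj₂ a≡1+Pa = cong odd a≡1+Pa

      odd⇒<m : (a : Fin (suc m)) → odd (toℕ a) ≡ true → toℕ a < m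
      odd⇒<m a odd-a = ≤∧≢⇒< (toℕ≤pred[n] a) λ a≡m → contradiction (trans (sym odd-a) (trans (cong odd a≡m) m-even)) λ ()

      even⇒odd-predMod : a ≢ zero → odd (toℕ a) ≡ false → odd (toℕ (P a)) ≡ true
      even⇒odd-predMod a≢0 even-a = not-injective (trans (sym (odd-predMod a≢0)) even-a)

      record Sides : Set where
        field
          side : Fin (suc m) → Bool
          side-S0 : side (S zero) ≡ true
          side-matching : odd (toℕ a) ≡ true → side (S a) ≡ side a
          side-chord : Chord G v a b → side a ≡ side b
          side-end : side zero ≡ true → side (P zero) ≡ false

      module _ (sides : Sides) where
        open Sides sides

        matchingColour chordSideColour firstColour lastColour : Bool → Fin 3
        matchingColour b = if b then 2F else 0F
        chordSideColour b = if b then 0F else 2F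
        firstColour b = if b then 1F else 0F
        lastColour b = if b then 2F else 1F

        matchingColour≢1F : ∀ b → matchingColour b ≢ 1F
        matchingColour≢1F true ()
        matchingColour≢1F false ()

        chordSideColour≢1F : ∀ b → chordSideColour b ≢ 1F
        chordSideColour≢1F true ()
        chordSideColour≢1F false ()

        chordSideColour≢matchingColour : ∀ b → chordSideColour b ≢ matchingColour b
        chordSideColour≢matchingColour true ()
        chordSideColour≢matchingColour false ()

        firstColour≢2F : ∀ b → firstColour b ≢ 2F
        firstColour≢2F true ()
        firstColour≢2F false ()

        colours-at-zero-distinct : ∀ b → chordSideColour b ≢ lastColour b × chordSideColour b ≢ firstColour b × lastColour b ≢ firstColour b
        colours-at-zero-distinct true = (λ ()) , (λ ()) , (λ ())
        colours-at-zero-distinct false = (λ ()) , (λ ()) , (λ ())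

        chordColour : Fin (suc m) → Fin 3
        chordColour a = chordSideColour (side a)

        innerColour : Fin (suc m) → Fin 3
        innerColour a = if odd (toℕ a) then matchingColour (side a) else 1F

        cycleColour : Fin (suc m) → Fin 3
        cycleColour a =
          if does (a ≟ zero) then firstColour (side zero)
          else if does (a ≟ P zero) then lastColour (side zero)
          else innerColour a

        cycleColour-first : cycleColour zero ≡ firstColour (side zero)
        cycleColour-first = refl

        cycleColour-last : cycleColour (P zero) ≡ lastColour (side zero)
        cycleColour-last rewrite dec-false (P zero ≟ zero) P0≢0 | dec-true (P zero ≟ P zero) refl = refl

        cycleColour-inner : a ≢ zero → a ≢ P zero → cycleColour a ≡ innerColour a
        cycleColour-inner {a} a≢0 a≢P0 rewrite dec-false (a ≟ zero) a≢0 | dec-false (a ≟ P zero) a≢P0 = refl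

        innerColour-odd : odd (toℕ a) ≡ true → innerColour a ≡ matchingColour (side a)
        innerColour-odd odd-a rewrite odd-a = refl

        innerColour-even : odd (toℕ a) ≡ false → innerColour a ≡ 1F
        innerColour-even even-a rewrite even-a = refl

        innerColour-proper : a ≢ zero → innerColour (P a) ≢ innerColour a
        innerColour-proper {a} a≢0 = by-parity (odd (toℕ (P a))) refl
          where
            by-parity : ∀ b → odd (toℕ (P a)) ≡ b → innerColour (P a) ≢ innerColour a
            by-parity true odd-Pa eq = matchingColour≢1F (side (P a))
              (trans (sym (innerColour-odd {P a} odd-Pa)) (trans eq (innerColour-even {a} (trans (odd-predMod a≢0) (cong not odd-Pa)))))
            by-parity false even-Pa eq = matchingColour≢1F (side a)
              (trans (sym (innerColour-odd {a} (trans (odd-predMod a≢0) (cong not even-Pa)))) (trans (sym eq) (innerColour-even {P a} even-Pa)))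

        chordColour≢innerColour : ∀ {a x} → (odd (toℕ x) ≡ true → side x ≡ side a) → chordColour a ≢ innerColour x
        chordColour≢innerColour {a} {x} same-side = by-parity (odd (toℕ x)) refl
          where
            by-parity : ∀ b → odd (toℕ x) ≡ b → chordColour a ≢ innerColour x
            by-parity true odd-x eq = chordSideColour≢matchingColour (side a)
              (trans eq (trans (innerColour-odd {x} odd-x) (cong matchingColour (same-side odd-x))))
            by-parity false even-x eq = chordSideColour≢1F (side a) (trans eq (innerColour-even {x} even-x))

        cycleColour-S0 : cycleColour (S zero) ≡ 2F
        cycleColour-S0 = begin
          cycleColour (S zero)             ≡⟨ cycleColour-inner S0≢0 (sucMod≢predMod 2≤m zero) ⟩
          innerColour (S zero)             ≡⟨ innerColour-odd {S zero} (cong odd (toℕ-sucMod 0<m)) ⟩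
          matchingColour (side (S zero))   ≡⟨ cong matchingColour side-S0 ⟩
          2F                               ∎
          where open ≡-Reasoning

        data Position (a : Fin (suc m)) : Set where
          at-zero : a ≡ zero → Position a
          after-zero : a ≡ S zero → Position a
          before-zero : a ≡ P zero → Position a
          elsewhere : a ≢ zero → a ≢ S zero → a ≢ P zero → Position a

        position : ∀ a → Position a
        position a with a ≟ zero | a ≟ S zero | a ≟ P zero
        ... | yes a≡0 | _ | _ = at-zero a≡0
        ... | no _ | yes a≡S0 | _ = after-zero a≡S0
        ... | no _ | no _ | yes a≡P0 = before-zero a≡P0
        ... | no a≢0 | no a≢S0 | no a≢P0 = elsewhere a≢0 a≢S0 a≢P0

        cycleColour-proper : ∀ a → cycleColour (P a) ≢ cycleColour a
        cycleColour-proper a with position a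
        ... | at-zero refl = λ eq →
          proj₂ (proj₂ (colours-at-zero-distinct (side zero))) (trans (sym cycleColour-last) (trans eq cycleColour-first))
        ... | after-zero refl = λ eq →
          firstColour≢2F (side zero) (trans (cong cycleColour (sym (predMod-sucMod zero))) (trans eq cycleColour-S0))
        ... | before-zero refl = λ eq → last-proper (side zero) refl
          (trans (sym (trans (cycleColour-inner PP0≢0 PP0≢P0) (innerColour-odd {P (P zero)} odd-PP0))) (trans eq cycleColour-last))
          where
            PP0≢0 : P (P zero) ≢ zero
            PP0≢0 eq = sucMod≢predMod 2≤m zero (sym (trans (sym (sucMod-predMod (P zero))) (cong S eq)))
            PP0≢P0 : P (P zero) ≢ P zero
            PP0≢P0 eq = P0≢0 (predMod-injective eq)
            odd-PP0 : odd (toℕ (P (P zero))) ≡ true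
            odd-PP0 = even⇒odd-predMod P0≢0 (trans (cong odd (toℕ-predMod-zero {m})) m-even)
            same-side : side (P (P zero)) ≡ side (P zero)
            same-side = trans (sym (side-matching odd-PP0)) (cong side (sucMod-predMod (P zero)))
            last-proper : ∀ b → side zero ≡ b → matchingColour (side (P (P zero))) ≢ lastColour b
            last-proper true s0 eq = contradiction (trans (sym (cong matchingColour (trans same-side (side-end s0)))) eq) λ ()
            last-proper false _ eq = matchingColour≢1F _ eq
        ... | elsewhere a≢0 a≢S0 a≢P0 = λ eq → innerColour-proper a≢0
          (trans (sym (cycleColour-inner (predMod≢zero a≢S0) (a≢0 ∘ predMod-injective))) (trans eq (cycleColour-inner a≢0 a≢P0)))

        chordColour≢predecessor : Chord G v a b → chordColour a ≢ cycleColour (P a)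
        chordColour≢predecessor {a} ch with position a
        ... | at-zero refl = λ eq → proj₁ (colours-at-zero-distinct (side zero)) (trans eq cycleColour-last)
        ... | after-zero refl = ⊥-elim (degree2⇒¬Chord deg-S0 ch)
        ... | before-zero refl = ⊥-elim (degree2⇒¬Chord deg-P0 ch)
        ... | elsewhere a≢0 a≢S0 _ = λ eq → chordColour≢innerColour same-side
          (trans eq (cycleColour-inner (predMod≢zero a≢S0) (a≢0 ∘ predMod-injective)))
          where
            same-side : odd (toℕ (P a)) ≡ true → side (P a) ≡ side a
            same-side odd-Pa = trans (sym (side-matching odd-Pa)) (cong side (sucMod-predMod a))

        chordColour≢successor : Chord G v a b → chordColour a ≢ cycleColour a
        chordColour≢successor {a} ch with position a
        ... | at-zero refl = λ eq → proj₁ (proj₂ (colours-at-zero-distinct (side zero))) (trans eq cycleColour-first)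
        ... | after-zero refl = ⊥-elim (degree2⇒¬Chord deg-S0 ch)
        ... | before-zero refl = ⊥-elim (degree2⇒¬Chord deg-P0 ch)
        ... | elsewhere a≢0 _ a≢P0 = λ eq → chordColour≢innerColour (λ _ → refl) (trans eq (cycleColour-inner a≢0 a≢P0))

        colouring : CycleChordColouring 3
        colouring = record
          { cycleColour = cycleColour
          ; chordColour = chordColour
          ; cycleColour-proper = cycleColour-proper
          ; chordColour-sym = cong chordSideColour ∘ side-chord
          ; chordColour≢predecessor = chordColour≢predecessor
          ; chordColour≢successor = chordColour≢successor
          }

      -- The partner of a in M; mate zero = P zero is junk.
      mate : Fin (suc m) → Fin (suc m)
      mate a = if odd (toℕ a) then S a else P a

      mate-odd : (a : Fin (suc m)) → odd (toℕ a) ≡ true → mate a ≡ S a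
      mate-odd a odd-a rewrite odd-a = refl

      mate-even : (a : Fin (suc m)) → odd (toℕ a) ≡ false → mate a ≡ P a
      mate-even a even-a rewrite even-a = refl

      odd-sucMod : (a : Fin (suc m)) → odd (toℕ a) ≡ true → odd (toℕ (S a)) ≡ false
      odd-sucMod a odd-a = trans (cong odd (toℕ-sucMod (odd⇒<m a odd-a))) (cong not odd-a)

      mate-involutive : a ≢ zero → mate (mate a) ≡ a
      mate-involutive {a} a≢0 = by-parity (odd (toℕ a)) refl
        where
          by-parity : ∀ b → odd (toℕ a) ≡ b → mate (mate a) ≡ a
          by-parity true odd-a = begin
            mate (mate a)  ≡⟨ cong mate (mate-odd a odd-a) ⟩
            mate (S a)     ≡⟨ mate-even (S a) (odd-sucMod a odd-a) ⟩
            P (S a)        ≡⟨ predMod-sucMod a ⟩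
            a              ∎
            where open ≡-Reasoning
          by-parity false even-a = begin
            mate (mate a)  ≡⟨ cong mate (mate-even a even-a) ⟩
            mate (P a)     ≡⟨ mate-odd (P a) odd-Pa ⟩
            S (P a)        ≡⟨ sucMod-predMod a ⟩
            a              ∎
            where
              open ≡-Reasoning
              odd-Pa : odd (toℕ (P a)) ≡ true
              odd-Pa = even⇒odd-predMod a≢0 even-a

      mate≢zero : (a : Fin (suc m)) → mate a ≢ zero
      mate≢zero a = by-parity (odd (toℕ a)) refl
        where
          by-parity : ∀ b → odd (toℕ a) ≡ b → mate a ≢ zero
          by-parity true odd-a eq = 1+n≢0 (trans (sym (toℕ-sucMod (odd⇒<m a odd-a))) (cong toℕ (trans (sym (mate-odd a odd-a)) eq)))
          by-parity false even-a eq with a ≟ zero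
          ... | yes refl = P0≢0 (trans (sym (mate-even zero even-a)) eq)
          ... | no a≢0 = contradiction
            (trans (sym (even⇒odd-predMod a≢0 even-a)) (cong (odd ∘ toℕ) (trans (sym (mate-even a even-a)) eq))) λ ()

      -- x, mate x, y are consecutive on an alternating path of H − v₀.
      Next : Fin (suc m) → Fin (suc m) → Set
      Next x y = x ≢ zero × Chord G v (mate x) y × y ≢ zero

      next? : ∀ x y → Dec (Next x y)
      next? x y = ¬? (x ≟ zero) ×-dec chord? (mate x) y ×-dec ¬? (y ≟ zero)

      next : Fin (suc m) → Maybe (Fin (suc m))
      next x = search (next? x)

      next-sound : ∀ {x y} → next x ≡ just y → Next x y
      next-sound {x} = search-sound (next? x)

      next-complete : ∀ {x y} → Next x y → next x ≡ just y
      next-complete {x} = search-complete (next? x) λ (_ , chy , _) (_ , chz , _) → Chord-unique chy chz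

      next-injective : ∀ {x y z} → next x ≡ just z → next y ≡ just z → x ≡ y
      next-injective {x} {y} nx ny with next-sound nx | next-sound ny
      ... | x≢0 , chx , _ | y≢0 , chy , _ = begin
        x              ≡⟨ sym (mate-involutive x≢0) ⟩
        mate (mate x)  ≡⟨ cong mate (Chord-unique (Chord-sym chx) (Chord-sym chy)) ⟩
        mate (mate y)  ≡⟨ mate-involutive y≢0 ⟩
        y              ∎
        where open ≡-Reasoning

      S0∉next : ∀ {x} → next x ≢ just (S zero)
      S0∉next nx = degree2⇒¬Chord deg-S0 (Chord-sym (proj₁ (proj₂ (next-sound nx))))

      open Orbit next next-injective (S zero) S0∉next

      Reached : Fin (suc m) → Set
      Reached a = OnOrbit a ⊎ OnOrbit (mate a)

      reached? : ∀ a → Dec (Reached a)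
      reached? a = onOrbit? a ⊎-dec onOrbit? (mate a)

      Reached-mate : a ≢ zero → Reached a → Reached (mate a)
      Reached-mate a≢0 (inj₁ on-a) = inj₂ (subst OnOrbit (sym (mate-involutive a≢0)) on-a)
      Reached-mate a≢0 (inj₂ on-mate) = inj₁ on-mate

      Reached-chord : a ≢ zero → b ≢ zero → Chord G v a b → Reached a → Reached b
      Reached-chord {a} {b} a≢0 b≢0 ch (inj₁ on-a) =
        inj₂ (backward on-a (next-complete (mate≢zero b , subst (λ c → Chord G v c a) (sym (mate-involutive b≢0)) (Chord-sym ch) , a≢0)))
      Reached-chord {a} {b} a≢0 b≢0 ch (inj₂ on-mate) =
        inj₁ (forward on-mate (next-complete (mate≢zero a , subst (λ c → Chord G v c b) (sym (mate-involutive a≢0)) ch , b≢0)))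

      Stuck : Fin (suc m) → Set
      Stuck a = ∀ {c} → Chord G v a c → c ≡ zero

      Reached-stuck : a ≢ zero → a ≢ S zero → Stuck a → Reached a → OnOrbit (mate a) × next (mate a) ≡ nothing
      Reached-stuck {a} a≢0 a≢S0 stuck (inj₁ on-a) = ⊥-elim (not-entered (predecessor on-a))
        where
          not-entered : ¬ (a ≡ S zero ⊎ ∃ λ x → OnOrbit x × next x ≡ just a)
          not-entered (inj₁ a≡S0) = a≢S0 a≡S0
          not-entered (inj₂ (x , _ , nx)) = mate≢zero x (stuck (Chord-sym (proj₁ (proj₂ (next-sound nx)))))
      Reached-stuck {a} a≢0 a≢S0 stuck (inj₂ on-mate) = on-mate , search-nothing (next? (mate a)) no-next
        where
          no-next : ∀ y → ¬ Next (mate a) y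
          no-next y (_ , ch , y≢0) = y≢0 (stuck (subst (λ c → Chord G v c y) (mate-involutive a≢0) ch))

      Reached-stuck-unique : a ≢ zero → a ≢ S zero → Stuck a → Reached a →
                             b ≢ zero → b ≢ S zero → Stuck b → Reached b → a ≡ b
      Reached-stuck-unique {a} {b} a≢0 a≢S0 stuck-a r-a b≢0 b≢S0 stuck-b r-b = begin
        a              ≡⟨ sym (mate-involutive a≢0) ⟩
        mate (mate a)  ≡⟨ cong mate (end-unique (proj₁ end-a) (proj₂ end-a) (proj₁ end-b) (proj₂ end-b)) ⟩
        mate (mate b)  ≡⟨ mate-involutive b≢0 ⟩
        b              ∎
        where
          open ≡-Reasoning
          end-a : OnOrbit (mate a) × next (mate a) ≡ nothing
          end-a = Reached-stuck a≢0 a≢S0 stuck-a r-a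
          end-b : OnOrbit (mate b) × next (mate b) ≡ nothing
          end-b = Reached-stuck b≢0 b≢S0 stuck-b r-b

      OnSide : Fin (suc m) → Set
      OnSide a = (a ≡ zero × ∃ λ j → Chord G v zero j × Reached j) ⊎ (a ≢ zero × Reached a)

      onSide? : ∀ a → Dec (OnSide a)
      onSide? a = ((a ≟ zero) ×-dec any? (λ j → chord? zero j ×-dec reached? j)) ⊎-dec (¬? (a ≟ zero) ×-dec reached? a)

      OnSide-matching : (a : Fin (suc m)) → odd (toℕ a) ≡ true → OnSide a ⇔ OnSide (S a)
      OnSide-matching a odd-a = mk⇔ to from
        where
          a≢0 : a ≢ zero
          a≢0 a≡0 = contradiction (trans (sym odd-a) (cong (odd ∘ toℕ) a≡0)) λ ()
          Sa≢0 : S a ≢ zero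
          Sa≢0 Sa≡0 = 1+n≢0 (trans (sym (toℕ-sucMod (odd⇒<m a odd-a))) (cong toℕ Sa≡0))
          to : OnSide a → OnSide (S a)
          to (inj₁ (a≡0 , _)) = ⊥-elim (a≢0 a≡0)
          to (inj₂ (_ , r)) = inj₂ (Sa≢0 , subst Reached (mate-odd a odd-a) (Reached-mate a≢0 r))
          from : OnSide (S a) → OnSide a
          from (inj₁ (Sa≡0 , _)) = ⊥-elim (Sa≢0 Sa≡0)
          from (inj₂ (_ , r)) = inj₂ (a≢0 , subst Reached mate-Sa (Reached-mate Sa≢0 r))
            where
              mate-Sa : mate (S a) ≡ a
              mate-Sa = trans (cong mate (sym (mate-odd a odd-a))) (mate-involutive a≢0)

      OnSide-chord : Chord G v a b → OnSide a → OnSide b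
      OnSide-chord ch (inj₁ (refl , j , ch0j , r-j)) =
        inj₂ (subst (λ b → b ≢ zero × Reached b) (Chord-unique ch0j ch) (Chord⇒≢ ch0j , r-j))
      OnSide-chord {a} {b} ch (inj₂ (a≢0 , r-a)) = by-cases (b ≟ zero)
        where
          by-cases : Dec (b ≡ zero) → OnSide b
          by-cases (yes b≡0) = inj₁ (b≡0 , a , subst (λ c → Chord G v c a) b≡0 (Chord-sym ch) , r-a)
          by-cases (no b≢0) = inj₂ (b≢0 , Reached-chord a≢0 b≢0 ch r-a)

      OnSide-end : OnSide zero → ¬ OnSide (P zero)
      OnSide-end (inj₂ (0≢0 , _)) _ = 0≢0 refl
      OnSide-end _ (inj₁ (P0≡0 , _)) = P0≢0 P0≡0
      OnSide-end (inj₁ (_ , j , ch0j , r-j)) (inj₂ (_ , r-P0)) = Chord⇒≢predMod ch0j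
        (Reached-stuck-unique (Chord⇒≢ ch0j) (proj₁ (proj₂ ch0j)) stuck-j r-j
                              P0≢0 (sucMod≢predMod 2≤m zero ∘ sym) (⊥-elim ∘ degree2⇒¬Chord deg-P0) r-P0)
        where
          stuck-j : Stuck j
          stuck-j ch = Chord-unique ch (Chord-sym ch0j)

      sides : Sides
      sides = record
        { side = does ∘ onSide?
        ; side-S0 = dec-true (onSide? (S zero)) (inj₂ (S0≢0 , inj₁ start))
        ; side-matching = λ {a} odd-a → sym (does-⇔ (OnSide-matching a odd-a) (onSide? a) (onSide? (S a)))
        ; side-chord = λ ch → does-⇔ (mk⇔ (OnSide-chord ch) (OnSide-chord (Chord-sym ch))) (onSide? _) (onSide? _)
        ; side-end = dec-false (onSide? (P zero)) ∘ OnSide-end ∘ does⇒ (onSide? zero)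
        }
        where
          does⇒ : {A : Set} (A? : Dec A) → does A? ≡ true → A
          does⇒ (yes a) _ = a

      colourable : EdgeColourable G 3
      colourable = edgeColourable (colouring sides)

    colourable-chord-after-degree2 : Chord G v zero b → degree G (v (P zero)) ≡ 2 → degree G (v (P b)) ≡ 2 →
      EdgeColourable G 3
    colourable-chord-after-degree2 ch deg-P0 deg-Pb = edgeColourable (ChordAfterDegree2.colouring _ ch deg-P0 deg-Pb)

    colourable-degree2-neighbours : odd m ≡ false → degree G (v (P zero)) ≡ 2 → degree G (v (S zero)) ≡ 2 →
      EdgeColourable G 3
    colourable-degree2-neighbours = Degree2Neighbours.colourable

module _ {n m} {G : Graph n} (subcubic : Subcubic G) (2≤m : 2 ≤ m) where

  chord-after-degree2⇒colourable : {v : Fin (suc m) → Fin n} → IsHamiltonianCycle G v → {i j : Fin (suc m)} →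
    Chord G v i j → degree G (v (predMod i)) ≡ 2 → degree G (v (predMod j)) ≡ 2 → EdgeColourable G 3
  chord-after-degree2⇒colourable {v} ham {i} {j} ch deg-Pi deg-Pj =
    HamiltonianCycle.colourable-chord-after-degree2 G (v ∘ ρ) (rotate-isHamiltonianCycle shift) 2≤m subcubic
      (Chord-rotate {G = G} {v = v} shift (subst₂ (Chord G v) (sym (rotate-toℕ i)) (sym (rotate-rotateBack shift j)) ch))
      (trans (cong (degree G ∘ v) (rotate-at-predMod (rotate-toℕ i))) deg-Pi)
      (trans (cong (degree G ∘ v) (rotate-at-predMod (rotate-rotateBack shift j))) deg-Pj)
    where
      open HamiltonianCycle G v ham 2≤m using (rotate-isHamiltonianCycle)
      shift : ℕ
      shift = toℕ i
      ρ : Fin (suc m) → Fin (suc m)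
      ρ = rotate shift
      rotate-at-predMod : ∀ {a b} → ρ a ≡ b → ρ (predMod a) ≡ predMod b
      rotate-at-predMod {a} eq = trans (rotate-predMod shift a) (cong predMod eq)

  chord-before-degree2⇒colourable : {v : Fin (suc m) → Fin n} → IsHamiltonianCycle G v → {i j : Fin (suc m)} →
    Chord G v i j → degree G (v (sucMod i)) ≡ 2 → degree G (v (sucMod j)) ≡ 2 → EdgeColourable G 3
  chord-before-degree2⇒colourable {v} ham {i} {j} ch deg-Si deg-Sj =
    chord-after-degree2⇒colourable opposite-isHamiltonianCycle {opposite i} {opposite j}
      (Chord-opposite {G = G} {v = v} (subst₂ (Chord G v) (sym (opposite-involutive i)) (sym (opposite-involutive j)) ch))
      (trans (cong (degree G ∘ v) (reflect-predMod i)) deg-Si)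
      (trans (cong (degree G ∘ v) (reflect-predMod j)) deg-Sj)
    where
      open HamiltonianCycle G v ham 2≤m using (opposite-isHamiltonianCycle)
      reflect-predMod : ∀ a → opposite (predMod (opposite a)) ≡ sucMod a
      reflect-predMod a = trans (opposite-predMod (opposite a)) (cong sucMod (opposite-involutive a))

  degree2-neighbours⇒colourable : {v : Fin (suc m) → Fin n} → IsHamiltonianCycle G v → odd m ≡ false →
    {i : Fin (suc m)} → degree G (v (predMod i)) ≡ 2 → degree G (v (sucMod i)) ≡ 2 → EdgeColourable G 3
  degree2-neighbours⇒colourable {v} ham m-even {i} deg-Pi deg-Si =
    HamiltonianCycle.colourable-degree2-neighbours G (v ∘ rotate shift) (rotate-isHamiltonianCycle shift) 2≤m subcubic m-even
      (trans (cong (degree G ∘ v) (trans (rotate-predMod shift zero) (cong predMod (rotate-toℕ i)))) deg-Pi)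
      (trans (cong (degree G ∘ v) (trans (rotate-sucMod shift zero) (cong sucMod (rotate-toℕ i)))) deg-Si)
    where
      open HamiltonianCycle G v ham 2≤m using (rotate-isHamiltonianCycle)
      shift : ℕ
      shift = toℕ i

odd-2* : ∀ p → odd (2 * p) ≡ false
odd-2* zero = refl
odd-2* (suc p) = trans (cong odd (*-suc 2 p)) (trans (not-involutive (odd (2 * p))) (odd-2* p))

IsHamiltonianCycle⇒2≤2*p : {G : Graph n} (p : ℕ) {v : Fin (suc (2 * p)) → Fin n} → IsHamiltonianCycle G v → 2 ≤ 2 * p
IsHamiltonianCycle⇒2≤2*p {G = G} zero ham = ⊥-elim (Edge-irrefl G (proj₂ (proj₂ ham) zero))
IsHamiltonianCycle⇒2≤2*p (suc p) _ = *-monoʳ-≤ 2 (s≤s z≤n)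

odd-Hamiltonian⇒¬EdgeColourable-<3 : {G : Graph n} (p : ℕ) {v : Fin (suc (2 * p)) → Fin n} →
  IsHamiltonianCycle G v → ∀ k → k < 3 → ¬ EdgeColourable G k
odd-Hamiltonian⇒¬EdgeColourable-<3 {G = G} p {v} ham k k<3 colourable =
  HamiltonianCycle.¬2-edge-colourable G v ham (IsHamiltonianCycle⇒2≤2*p {G = G} p ham) (odd-2* p)
    (EdgeColourable-mono {G = G} (≤-pred k<3) colourable)

lemma1 : ∀ {n} (G : Graph n) (p : ℕ) (v : Fin (suc (2 * p)) → Fin n) →
    Subcubic G →
    IsHamiltonianCycle G v →
    (Σ (Fin (suc (2 * p))) (λ i → Σ (Fin (suc (2 * p))) (λ j →
        Edge G (v i) (v j) × j ≢ sucMod i × i ≢ sucMod j ×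
        degree G (v (predMod i)) ≡ 2 × degree G (v (predMod j)) ≡ 2))
      ⊎ (Σ (Fin (suc (2 * p))) (λ i → Σ (Fin (suc (2 * p))) (λ j →
        Edge G (v i) (v j) × j ≢ sucMod i × i ≢ sucMod j ×
        degree G (v (sucMod i)) ≡ 2 × degree G (v (sucMod j)) ≡ 2))
      ⊎ Σ (Fin (suc (2 * p))) (λ i →
        degree G (v (predMod i)) ≡ 2 × degree G (v (sucMod i)) ≡ 2))) →
    ChromaticIndexIs G 3
lemma1 G p v subcubic ham (inj₁ (i , j , e , j≢Si , i≢Sj , deg-Pi , deg-Pj)) =
  chord-after-degree2⇒colourable {G = G} subcubic (IsHamiltonianCycle⇒2≤2*p {G = G} p ham) ham {i} {j} (e , j≢Si , i≢Sj) deg-Pi deg-Pj ,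
  odd-Hamiltonian⇒¬EdgeColourable-<3 {G = G} p ham
lemma1 G p v subcubic ham (inj₂ (inj₁ (i , j , e , j≢Si , i≢Sj , deg-Si , deg-Sj))) =
  chord-before-degree2⇒colourable {G = G} subcubic (IsHamiltonianCycle⇒2≤2*p {G = G} p ham) ham {i} {j} (e , j≢Si , i≢Sj) deg-Si deg-Sj ,
  odd-Hamiltonian⇒¬EdgeColourable-<3 {G = G} p ham
lemma1 G p v subcubic ham (inj₂ (inj₂ (i , deg-Pi , deg-Si))) =
  degree2-neighbours⇒colourable {G = G} subcubic (IsHamiltonianCycle⇒2≤2*p {G = G} p ham) ham (odd-2* p) {i} deg-Pi deg-Si ,
  odd-Hamiltonian⇒¬EdgeColourable-<3 {G = G} p ham
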